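{- Let $s$ be an even integer and $t$ an odd integer. For every integer $n\ge1$, $$\nu(\{n\})=\begin{cases}\nu(sn/2) & \text{if $n$ is even},\\ 0 & \text{if $n$ is odd}.\end{cases}$$
   Context: For integers $s,t$, let $\{n\}=\{n\}_{s,t}$ be defined by $\{0\}=0$, $\{1\}=1$, $\{n\}=s\{n-1\}+t\{n-2\}$ for $n\ge2$. $\nu=\nu_2$ is the $2$-adic valuation: the exponent of the highest power of $2$ dividing a nonzero integer, with $\nu(0)=\infty$. -}

module Defs where

open import Data.Nat as ℕ using (ℕ; zero; suc)
open import Data.Integer using (ℤ; +_; _+_; _*_; ∣_∣)
open import Data.Maybe using (Maybe; just; nothing; map)

lucas : ℤ → ℤ → ℕ → ℤ
lucas s t zero = + 0
lucas s t (suc zero) = + 1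
lucas s t (suc (suc n)) = s * lucas s t (suc n) + t * lucas s t n

-- Extended naturals for valuations: nothing = ∞.
ℕ∞ : Set
ℕ∞ = Maybe ℕ

-- 2-adic valuation of a natural number, with fuel (fuel m ≥ m suffices).
ν₂ℕ-fuel : ℕ → ℕ → ℕ
ν₂ℕ-fuel zero m = zero
ν₂ℕ-fuel (suc f) zero = zero
ν₂ℕ-fuel (suc f) (suc zero) = zero
ν₂ℕ-fuel (suc f) (suc (suc m)) with ℕ._%_ (suc (suc m)) 2
... | zero = suc (ν₂ℕ-fuel f (ℕ._/_ (suc (suc m)) 2))
... | suc _ = zero

ν : ℤ → ℕ∞
ν z with ∣ z ∣
... | zero = nothing
... | suc m = just (ν₂ℕ-fuel (suc m) (suc m))

module Submission where

-- Let s be even and t odd, and write {n} = {n}_{s,t}.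
--
--  * Odd-indexed terms are odd: modulo 2 the recurrence reads {n} ≡ {n-2}.
--  * Doubling: m ↦ {2m} satisfies the recurrence with parameters c = s² + 2t,
--    d = -t², and starts 0, s; hence {2m}_{s,t} = s·{m}_{c,d}.  Here c is twice
--    an odd number and d is odd, so (c,d) is again of type (even, odd).
--
-- Write x ≈ₒ y when x·a = y·b for some odd a, b.  Strong induction on m gives
-- {2m}_{s,t} ≈ₒ s·m: for odd m both {m}_{c,d} and m are odd, and for m = 2k the
-- induction hypothesis for (c,d) gives {2m}_{s,t} = s·{2k}_{c,d} ≈ₒ s·c·k ≈ₒ s·2k.
-- As ν is invariant under odd factors, ν({2m}) = ν(s·m) = ν(s·2m/2) and
-- ν({2m+1}) = 0.

open import Defs
open import Data.Nat using (ℕ; _≥_)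
open import Data.Nat.Divisibility using () renaming (_∣_ to _∣ℕ_)
open import Data.Integer using (ℤ; +_; _*_)
open import Data.Integer.Divisibility using (_∣_)
open import Data.Integer.DivMod using (_/ℕ_)
open import Data.Maybe using (just)
open import Data.Product using (_×_)
open import Relation.Binary.PropositionalEquality using (_≡_)
open import Relation.Nullary using (¬_)

import Data.Nat as ℕ
import Data.Nat.Properties as ℕₚ
import Data.Nat.DivMod as ℕ
import Data.Nat.Tactic.RingSolver as ℕ-Solver
open import Data.Nat using (zero; suc; s≤s)
open import Data.Nat.Divisibility using (divides)
open import Data.Nat.Induction using (<-rec)
open import Data.Integer using (-[1+_]; _+_; -_; ∣_∣)
import Data.Integer.Properties as ℤₚ
open import Data.Integer.Tactic.RingSolver using (solve-∀)
open import Data.Maybe using (nothing)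
open import Data.Product using (Σ; _,_)
open import Function using (_∘_)
open import Relation.Nullary using (contradiction)
open import Relation.Binary.PropositionalEquality
  using (refl; sym; trans; cong; cong₂; subst; module ≡-Reasoning)

-- Parity of natural numbers, as a view whose indices reduce well:
-- suc k * 2 is definitionally suc (suc (k * 2)).
data ParityView : ℕ → Set where
  even : ∀ k → ParityView (k ℕ.* 2)
  odd  : ∀ k → ParityView (suc (k ℕ.* 2))

parityView : ∀ n → ParityView n
parityView zero = even zero
parityView (suc zero) = odd zero
parityView (suc (suc n)) with parityView n
... | even k = even (suc k)
... | odd k  = odd (suc k)

odd%2 : ∀ k → suc (k ℕ.* 2) ℕ.% 2 ≡ 1
odd%2 k = ℕ.[m+kn]%n≡m%n 1 k 2

odd-not-even : ∀ k → ¬ (2 ∣ℕ suc (k ℕ.* 2))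
odd-not-even k (divides q eq) with trans (sym (odd%2 k)) (trans (cong (ℕ._% 2) eq) (ℕ.m*n%n≡0 q 2))
... | ()

odd-*-odd : ∀ k j →
  suc (k ℕ.* 2) ℕ.* suc (j ℕ.* 2) ≡ suc ((j ℕ.+ k ℕ.* suc (j ℕ.* 2)) ℕ.* 2)
odd-*-odd = ℕ-Solver.solve-∀

even-*-odd : ∀ k j → (k ℕ.* 2) ℕ.* suc (j ℕ.* 2) ≡ (k ℕ.* suc (j ℕ.* 2)) ℕ.* 2
even-*-odd = ℕ-Solver.solve-∀

ν₂-fuel-zero : ∀ f → ν₂ℕ-fuel f 0 ≡ 0
ν₂-fuel-zero zero = refl
ν₂-fuel-zero (suc f) = refl

ν₂-fuel-odd : ∀ f k → ν₂ℕ-fuel f (suc (k ℕ.* 2)) ≡ 0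
ν₂-fuel-odd zero k = refl
ν₂-fuel-odd (suc f) zero = refl
ν₂-fuel-odd (suc f) (suc k) with suc (suc k ℕ.* 2) ℕ.% 2 | odd%2 (suc k)
... | suc _ | _ = refl

ν₂-fuel-even : ∀ f k → ν₂ℕ-fuel (suc f) (suc k ℕ.* 2) ≡ suc (ν₂ℕ-fuel f (suc k))
ν₂-fuel-even f k with suc k ℕ.* 2 ℕ.% 2 | ℕ.m*n%n≡0 (suc k) 2
... | zero | _ = cong (suc ∘ ν₂ℕ-fuel f) (ℕ.m*n/n≡m (suc k) 2)

halve-bound : ∀ {w f} → suc w ℕ.* 2 ℕ.≤ suc f → suc w ℕ.≤ f
halve-bound {w} (s≤s w2<f) = ℕₚ.≤-trans (s≤s (ℕₚ.m≤m*n w 2)) w2<f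

ν₂-fuel-*-odd : ∀ f g m j → m ℕ.* suc (j ℕ.* 2) ℕ.≤ f → m ℕ.≤ g →
  ν₂ℕ-fuel f (m ℕ.* suc (j ℕ.* 2)) ≡ ν₂ℕ-fuel g m
ν₂-fuel-*-odd f g m j mu≤f m≤g with parityView m
... | even zero = trans (ν₂-fuel-zero f) (sym (ν₂-fuel-zero g))
... | odd k =
  trans (cong (ν₂ℕ-fuel f) (odd-*-odd k j))
        (trans (ν₂-fuel-odd f (j ℕ.+ k ℕ.* suc (j ℕ.* 2))) (sym (ν₂-fuel-odd g k)))
... | even (suc k) =
  trans (cong (ν₂ℕ-fuel f) (even-*-odd (suc k) j))
        (halve f g (subst (ℕ._≤ f) (even-*-odd (suc k) j) mu≤f) m≤g)
  where
  open ≡-Reasoning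
  u = suc (j ℕ.* 2)
  halve : ∀ f g → (suc k ℕ.* u) ℕ.* 2 ℕ.≤ f → suc k ℕ.* 2 ℕ.≤ g →
    ν₂ℕ-fuel f ((suc k ℕ.* u) ℕ.* 2) ≡ ν₂ℕ-fuel g (suc k ℕ.* 2)
  halve zero _ () _
  halve (suc _) zero _ ()
  halve (suc f′) (suc g′) ku2≤f k2≤g = begin
    ν₂ℕ-fuel (suc f′) ((suc k ℕ.* u) ℕ.* 2)  ≡⟨ ν₂-fuel-even f′ _ ⟩
    suc (ν₂ℕ-fuel f′ (suc k ℕ.* u))          ≡⟨ cong suc (ν₂-fuel-*-odd f′ g′ (suc k) j
                                                   (halve-bound ku2≤f) (halve-bound k2≤g)) ⟩
    suc (ν₂ℕ-fuel g′ (suc k))                ≡⟨ sym (ν₂-fuel-even g′ k) ⟩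
    ν₂ℕ-fuel (suc g′) (suc k ℕ.* 2)          ∎

νℕ : ℕ → ℕ∞
νℕ zero = nothing
νℕ (suc m) = just (ν₂ℕ-fuel (suc m) (suc m))

ν-abs : ∀ z → ν z ≡ νℕ ∣ z ∣
ν-abs (+ zero) = refl
ν-abs (+ suc n) = refl
ν-abs -[1+ n ] = refl

νℕ-*-odd : ∀ a j → νℕ (a ℕ.* suc (j ℕ.* 2)) ≡ νℕ a
νℕ-*-odd zero j = refl
νℕ-*-odd (suc m) j = cong just (ν₂-fuel-*-odd _ (suc m) (suc m) j ℕₚ.≤-refl ℕₚ.≤-refl)

-- Parity of integers, with explicit halves so that the ring solver applies.
Even : ℤ → Set
Even x = Σ ℤ λ k → x ≡ k * + 2

Odd : ℤ → Set
Odd x = Σ ℤ λ k → x ≡ + 1 + k * + 2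

even-pos : ∀ q → Even (+ (q ℕ.* 2))
even-pos q = + q , ℤₚ.pos-* q 2

odd-pos : ∀ q → Odd (+ suc (q ℕ.* 2))
odd-pos q = + q , cong (λ y → + 1 + y) (ℤₚ.pos-* q 2)

even-neg : ∀ {x} → Even x → Even (- x)
even-neg (k , refl) = - k , ℤₚ.neg-distribˡ-* k (+ 2)

odd-neg : ∀ {x} → Odd x → Odd (- x)
odd-neg (k , refl) = - + 1 + - k , negation k
  where
  negation : ∀ k → - (+ 1 + k * + 2) ≡ + 1 + (- + 1 + - k) * + 2
  negation = solve-∀

odd-* : ∀ {x y} → Odd x → Odd y → Odd (x * y)
odd-* (a , refl) (b , refl) = a + b + a * b * + 2 , product a b
  where
  product : ∀ a b → (+ 1 + a * + 2) * (+ 1 + b * + 2) ≡ + 1 + (a + b + a * b * + 2) * + 2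
  product = solve-∀

odd-abs : ∀ {u} → Odd u → Σ ℕ λ j → ∣ u ∣ ≡ suc (j ℕ.* 2)
odd-abs (+ k , refl) = k , cong (λ y → ∣ + 1 + y ∣) (sym (ℤₚ.pos-* k 2))
odd-abs (-[1+ k ] , refl) = k , refl

from-abs : (P : ℤ → Set) → (∀ {y} → P y → P (- y)) → ∀ x → P (+ ∣ x ∣) → P x
from-abs P neg (+ n) p = p
from-abs P neg -[1+ n ] p = neg p

divisible⇒even : ∀ x → + 2 ∣ x → Even x
divisible⇒even x (divides q eq) = from-abs Even even-neg x (subst (Even ∘ +_) (sym eq) (even-pos q))

not-divisible⇒odd : ∀ x → ¬ (+ 2 ∣ x) → Odd x
not-divisible⇒odd x = odd-of-abs ∣ x ∣ refl
  where
  odd-of-abs : ∀ n → ∣ x ∣ ≡ n → ¬ (2 ∣ℕ n) → Odd x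
  odd-of-abs n eq ¬2∣n with parityView n
  ... | even k = contradiction (divides k refl) ¬2∣n
  ... | odd k = from-abs Odd odd-neg x (subst (Odd ∘ +_) (sym eq) (odd-pos k))

ν-*-odd : ∀ x {u} → Odd u → ν (x * u) ≡ ν x
ν-*-odd x {u} u-odd with odd-abs u-odd
... | j , ∣u∣≡ = begin
  ν (x * u)                        ≡⟨ ν-abs (x * u) ⟩
  νℕ ∣ x * u ∣                     ≡⟨ cong νℕ (trans (ℤₚ.abs-* x u) (cong (∣ x ∣ ℕ.*_) ∣u∣≡)) ⟩
  νℕ (∣ x ∣ ℕ.* suc (j ℕ.* 2))     ≡⟨ νℕ-*-odd ∣ x ∣ j ⟩
  νℕ ∣ x ∣                         ≡⟨ sym (ν-abs x) ⟩
  ν x                              ∎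
  where open ≡-Reasoning

ν-odd : ∀ {u} → Odd u → ν u ≡ just 0
ν-odd {u} u-odd = trans (cong ν (sym (ℤₚ.*-identityˡ u))) (ν-*-odd (+ 1) u-odd)

infix 4 _≈ₒ_

data _≈ₒ_ (x y : ℤ) : Set where
  odd-factors : ∀ a b → Odd a → Odd b → x * a ≡ y * b → x ≈ₒ y

≈ₒ-reflexive : ∀ {x y} → x ≡ y → x ≈ₒ y
≈ₒ-reflexive refl = odd-factors (+ 1) (+ 1) (+ 0 , refl) (+ 0 , refl) refl

≈ₒ-trans : ∀ {x y z} → x ≈ₒ y → y ≈ₒ z → x ≈ₒ z
≈ₒ-trans {x} {y} {z} (odd-factors a b a-odd b-odd xa≡yb) (odd-factors a′ b′ a′-odd b′-odd ya′≡zb′) =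
  odd-factors (a * a′) (b′ * b) (odd-* a-odd a′-odd) (odd-* b′-odd b-odd) (begin
    x * (a * a′)   ≡⟨ sym (ℤₚ.*-assoc x a a′) ⟩
    x * a * a′     ≡⟨ cong (_* a′) xa≡yb ⟩
    y * b * a′     ≡⟨ swap y b a′ ⟩
    y * a′ * b     ≡⟨ cong (_* b) ya′≡zb′ ⟩
    z * b′ * b     ≡⟨ ℤₚ.*-assoc z b′ b ⟩
    z * (b′ * b)   ∎)
  where
  open ≡-Reasoning
  swap : ∀ p q r → p * q * r ≡ p * r * q
  swap = solve-∀

module ≈ₒ-Reasoning where
  infix 1 begin_
  infixr 2 _≈⟨_⟩_ _≡⟨_⟩_
  infix 3 _∎

  begin_ : ∀ {x y} → x ≈ₒ y → x ≈ₒ y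
  begin x≈y = x≈y

  _≈⟨_⟩_ : ∀ x {y z} → x ≈ₒ y → y ≈ₒ z → x ≈ₒ z
  x ≈⟨ x≈y ⟩ y≈z = ≈ₒ-trans x≈y y≈z

  _≡⟨_⟩_ : ∀ x {y z} → x ≡ y → y ≈ₒ z → x ≈ₒ z
  x ≡⟨ refl ⟩ y≈z = y≈z

  _∎ : ∀ x → x ≈ₒ x
  x ∎ = ≈ₒ-reflexive refl

≈ₒ-*ˡ : ∀ z {x y} → x ≈ₒ y → z * x ≈ₒ z * y
≈ₒ-*ˡ z {x} {y} (odd-factors a b a-odd b-odd xa≡yb) = odd-factors a b a-odd b-odd (begin
  z * x * a     ≡⟨ ℤₚ.*-assoc z x a ⟩
  z * (x * a)   ≡⟨ cong (z *_) xa≡yb ⟩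
  z * (y * b)   ≡⟨ sym (ℤₚ.*-assoc z y b) ⟩
  z * y * b     ∎)
  where open ≡-Reasoning

*-odd-≈ₒ : ∀ x {u} → Odd u → x * u ≈ₒ x
*-odd-≈ₒ x {u} u-odd = odd-factors (+ 1) u (+ 0 , refl) u-odd (ℤₚ.*-identityʳ (x * u))

odd-≈ₒ-odd : ∀ {u v} → Odd u → Odd v → u ≈ₒ v
odd-≈ₒ-odd {u} {v} u-odd v-odd = odd-factors v u v-odd u-odd (ℤₚ.*-comm u v)

≈ₒ⇒ν≡ : ∀ {x y} → x ≈ₒ y → ν x ≡ ν y
≈ₒ⇒ν≡ {x} {y} (odd-factors a b a-odd b-odd xa≡yb) = begin
  ν x         ≡⟨ sym (ν-*-odd x a-odd) ⟩
  ν (x * a)   ≡⟨ cong ν xa≡yb ⟩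
  ν (y * b)   ≡⟨ ν-*-odd y b-odd ⟩
  ν y         ∎
  where open ≡-Reasoning

even-*ʳ : ∀ {x} y → Even x → Even (x * y)
even-*ʳ y (a , refl) = a * y , regroup a y
  where
  regroup : ∀ a y → a * + 2 * y ≡ a * y * + 2
  regroup = solve-∀

even-+-odd : ∀ {x w} → Even x → Odd w → Odd (x + w)
even-+-odd (a , refl) (b , refl) = a + b , regroup a b
  where
  regroup : ∀ a b → a * + 2 + (+ 1 + b * + 2) ≡ + 1 + (a + b) * + 2
  regroup = solve-∀

odd-terms-odd : ∀ {s t} → Even s → Odd t → ∀ k → Odd (lucas s t (suc (k ℕ.* 2)))
odd-terms-odd s-even t-odd zero = + 0 , refl
odd-terms-odd s-even t-odd (suc k) =
  even-+-odd (even-*ʳ _ s-even) (odd-* t-odd (odd-terms-odd s-even t-odd k))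

scaled-solution : ∀ s t a (f : ℕ → ℤ) → f 0 ≡ + 0 → f 1 ≡ a →
  (∀ n → f (suc (suc n)) ≡ s * f (suc n) + t * f n) → ∀ n → f n ≡ a * lucas s t n
scaled-solution s t a f f0 f1 rec zero = trans f0 (sym (ℤₚ.*-zeroʳ a))
scaled-solution s t a f f0 f1 rec (suc zero) = trans f1 (sym (ℤₚ.*-identityʳ a))
scaled-solution s t a f f0 f1 rec (suc (suc n)) = begin
  f (suc (suc n))                                      ≡⟨ rec n ⟩
  s * f (suc n) + t * f n                              ≡⟨ cong₂ (λ p q → s * p + t * q)
                                                            (scaled-solution s t a f f0 f1 rec (suc n))
                                                            (scaled-solution s t a f f0 f1 rec n) ⟩
  s * (a * lucas s t (suc n)) + t * (a * lucas s t n)  ≡⟨ factor s t a _ _ ⟩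
  a * lucas s t (suc (suc n))                          ∎
  where
  open ≡-Reasoning
  factor : ∀ s t a A B → s * (a * A) + t * (a * B) ≡ a * (s * A + t * B)
  factor = solve-∀

doubledS : ℤ → ℤ → ℤ
doubledS s t = s * s + + 2 * t

doubledT : ℤ → ℤ
doubledT t = - (t * t)

even-terms-recurrence : ∀ s t m → lucas s t (suc (suc m) ℕ.* 2) ≡
  doubledS s t * lucas s t (suc m ℕ.* 2) + doubledT t * lucas s t (m ℕ.* 2)
even-terms-recurrence s t m = unfold s t (lucas s t (suc (m ℕ.* 2))) (lucas s t (m ℕ.* 2))
  where
  unfold : ∀ s t A B → s * (s * (s * A + t * B) + t * A) + t * (s * A + t * B)
                     ≡ (s * s + + 2 * t) * (s * A + t * B) + - (t * t) * B
  unfold = solve-∀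

doubling : ∀ s t m → lucas s t (m ℕ.* 2) ≡ s * lucas (doubledS s t) (doubledT t) m
doubling s t = scaled-solution (doubledS s t) (doubledT t) s (λ m → lucas s t (m ℕ.* 2))
  refl (second-term s t) (even-terms-recurrence s t)
  where
  second-term : ∀ s t → s * + 1 + t * + 0 ≡ s
  second-term = solve-∀

doubledS-twice-odd : ∀ {s t} → Even s → Odd t → Σ ℤ λ c′ → Odd c′ × (doubledS s t ≡ c′ * + 2)
doubledS-twice-odd (e , refl) (f , refl) = + 1 + (e * e + f) * + 2 , (e * e + f , refl) , expand e f
  where
  expand : ∀ e f → e * + 2 * (e * + 2) + + 2 * (+ 1 + f * + 2) ≡ (+ 1 + (e * e + f) * + 2) * + 2
  expand = solve-∀

doubledS-even : ∀ {s t} → Even s → Odd t → Even (doubledS s t)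
doubledS-even s-even t-odd with doubledS-twice-odd s-even t-odd
... | c′ , _ , c≡ = c′ , c≡

doubledT-odd : ∀ {t} → Odd t → Odd (doubledT t)
doubledT-odd t-odd = odd-neg (odd-* t-odd t-odd)

even-terms-≈ₒ : ∀ m {s t} → Even s → Odd t → lucas s t (m ℕ.* 2) ≈ₒ s * + m
even-terms-≈ₒ = <-rec Relation step
  where
  Relation : ℕ → Set
  Relation m = ∀ {s t} → Even s → Odd t → lucas s t (m ℕ.* 2) ≈ₒ s * + m

  step : ∀ m → (∀ {k} → k ℕ.< m → Relation k) → Relation m
  step m ih {s} {t} s-even t-odd with parityView m
  ... | even zero = ≈ₒ-reflexive (sym (ℤₚ.*-zeroʳ s))
  ... | odd k = begin
    lucas s t (m′ ℕ.* 2)   ≡⟨ doubling s t m′ ⟩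
    s * lucas c d m′       ≈⟨ ≈ₒ-*ˡ s (odd-≈ₒ-odd (odd-terms-odd c-even d-odd k) (odd-pos k)) ⟩
    s * + m′               ∎
    where
    open ≈ₒ-Reasoning
    m′ = suc (k ℕ.* 2)
    c = doubledS s t
    d = doubledT t
    c-even = doubledS-even s-even t-odd
    d-odd = doubledT-odd t-odd
  ... | even (suc k) with doubledS-twice-odd s-even t-odd
  ...   | c′ , c′-odd , c≡ = begin
    lucas s t (m′ ℕ.* 2)           ≡⟨ doubling s t m′ ⟩
    s * lucas c d (suc k ℕ.* 2)    ≈⟨ ≈ₒ-*ˡ s (ih k<m′ (doubledS-even s-even t-odd) (doubledT-odd t-odd)) ⟩
    s * (c * + suc k)              ≡⟨ rescale ⟩
    s * + m′ * c′                  ≈⟨ *-odd-≈ₒ (s * + m′) c′-odd ⟩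
    s * + m′                       ∎
    where
    open ≈ₒ-Reasoning
    m′ = suc k ℕ.* 2
    c = doubledS s t
    d = doubledT t

    k<m′ : suc k ℕ.< m′
    k<m′ = s≤s (s≤s (ℕₚ.m≤m*n k 2))

    regroup : ∀ s c′ K → s * (c′ * + 2 * K) ≡ s * (K * + 2) * c′
    regroup = solve-∀

    rescale : s * (c * + suc k) ≡ s * + m′ * c′
    rescale = trans (cong (λ c → s * (c * + suc k)) c≡)
             (trans (regroup s c′ (+ suc k)) (cong (λ K → s * K * c′) (sym (ℤₚ.pos-* (suc k) 2))))

*2-/ℕ2 : ∀ x → (x * + 2) /ℕ 2 ≡ x
*2-/ℕ2 (+ k) = trans (cong (_/ℕ 2) (sym (ℤₚ.pos-* k 2))) (cong +_ (ℕ.m*n/n≡m k 2))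
*2-/ℕ2 -[1+ k ] with suc k ℕ.* 2 ℕ.% 2 | ℕ.m*n%n≡0 (suc k) 2
... | zero | _ = cong (-_ ∘ +_) (ℕ.m*n/n≡m (suc k) 2)

half-s·2k : ∀ s k → (s * + (k ℕ.* 2)) /ℕ 2 ≡ s * + k
half-s·2k s k = trans (cong (λ y → (s * y) /ℕ 2) (ℤₚ.pos-* k 2))
                      (trans (cong (_/ℕ 2) (sym (ℤₚ.*-assoc s (+ k) (+ 2)))) (*2-/ℕ2 (s * + k)))

lemma3p3 : (s t : ℤ) → + 2 ∣ s → ¬ (+ 2 ∣ t) →
    (n : ℕ) → n ≥ 1 →
      (2 ∣ℕ n → ν (lucas s t n) ≡ ν ((s * + n) /ℕ 2))
      × (¬ (2 ∣ℕ n) → ν (lucas s t n) ≡ just 0)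
lemma3p3 s t 2∣s 2∤t n _ with parityView n | divisible⇒even s 2∣s | not-divisible⇒odd t 2∤t
... | even k | s-even | t-odd =
  (λ _ → trans (≈ₒ⇒ν≡ (even-terms-≈ₒ k s-even t-odd)) (cong ν (sym (half-s·2k s k)))) ,
  (λ 2∤n → contradiction (divides k refl) 2∤n)
... | odd k | s-even | t-odd =
  (λ 2∣n → contradiction 2∣n (odd-not-even k)) ,
  (λ _ → ν-odd (odd-terms-odd s-even t-odd k))
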